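{- Let $(G,k,(V_1,\dots,V_k))$ be an instance of \textsc{Multicolored Clique}, and let $G'$, $S=V\cup X\cup U$, $T=V\cup Y\cup U$ and $\ell=8\binom{k}{2}+2k$ be as constructed in the context. If $(G,k,(V_1,\dots,V_k))$ is a yes-instance, then there is a sequence of at most $\ell$ token slides transforming $S$ into $T$ in $G'$.
   Context: \textsc{Multicolored Clique}: given $G$ with vertex set $V$ partitioned into $V_1,\dots,V_k$ (no edges inside a class), decide whether $G$ has a clique with one vertex in each class. Construction: $m=\binom{k}{2}$. Take $V$; for each edge $e=\{u,v\}$ of $G$ add a vertex $v_e$ adjacent to $u,v$. $\mathcal{E}_{ij}$ = set of $v_e$ with $e$ between $V_i$ and $V_j$ ($i\ne j$, unordered); label the $m$ sets $\mathcal{E}_{ij}$ bijectively by $1,\dots,m$. Add independent sets $X=\{x_1,\dots,x_m\}$, $Y=\{y_1,\dots,y_m\}$; for each $b$ and each $v_e$ in the set labeled $b$, join $x_b$ to $v_e$ and $y_b$ to $v_e$ each by a path with three new internal vertices. $U_1$ (resp. $U_2$) is the set of middle internal vertices of the paths from $X$ (resp. $Y$); $U=U_1\cup U_2$. For each $v\in V$ add a vertex $z_v$ adjacent only to $v$. A token slide transforms an independent set $I$ into $(I\setminus\{u\})\cup\{w\}$ where $u\in I$, $w\notin I$, $\{u,w\}\in E(G')$, and the result is independent. -}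

module Defs where

open import Level using (Level) renaming (suc to lsuc)
open import Data.Nat using (ℕ; zero; suc; _+_; _*_)
open import Data.Nat.Combinatorics using (_C_)
open import Data.Fin using (Fin; _<_) renaming (zero to 0F; suc to sucF)
open import Data.Product using (Σ; ∃; ∃-syntax; _×_; _,_; proj₁; proj₂)
open import Data.Sum using (_⊎_)
open import Data.Unit using (⊤)
open import Data.Empty using (⊥)
open import Relation.Nullary using (¬_)
open import Relation.Binary.PropositionalEquality using (_≡_; _≢_)
open import Function.Bundles using (_↔_; Inverse)
open import Function.Definitions using (Injective)

-- Vertices of G are Fin n; the partition V_1..V_k is given by a colour
-- function col : Fin n → Fin k (V_i = col⁻¹ i).  Edges of G are listed
-- without repetition as edge : Fin m → Fin n × Fin n; since there are no
-- edges inside a class, every edge joins two different classes, and we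
-- orient each (undirected) edge {u,v} so that col u < col v.

record MCInstance : Set where
  field
    n k m    : ℕ
    col      : Fin n → Fin k
    edge     : Fin m → Fin n × Fin n
    edge-col : ∀ e → col (proj₁ (edge e)) < col (proj₂ (edge e))
    edge-inj : Injective _≡_ _≡_ edge

-- Unordered pairs {i,j}, i ≠ j, of classes, represented as i < j.
Pair : ℕ → Set
Pair k = Σ (Fin k × Fin k) (λ p → proj₁ p < proj₂ p)

YesInstance : MCInstance → Set
YesInstance I =
  Σ (Fin k → Fin n) λ f →
    (∀ i → col (f i) ≡ i) ×
    (∀ i j → i < j → ∃[ e ] edge e ≡ (f i , f j))
  where open MCInstance I

module TokenSliding {V : Set} (Adj : V → V → Set) where

  VSet : Set₁
  VSet = V → Set

  _≐_ : VSet → VSet → Set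
  A ≐ B = ∀ x → (A x → B x) × (B x → A x)

  Independent : VSet → Set
  Independent A = ∀ x y → A x → A y → ¬ Adj x y

  Slide : VSet → VSet → Set
  Slide I J = Σ V λ u → Σ V λ w →
    I u × ¬ I w × Adj u w ×
    (∀ x → (J x → (I x × x ≢ u) ⊎ x ≡ w) × ((I x × x ≢ u) ⊎ x ≡ w → J x)) ×
    Independent J

  data SlideSeq : ℕ → VSet → VSet → Set₁ where
    done : ∀ {t I J} → I ≐ J → SlideSeq t I J
    step : ∀ {t I K J} → Slide I K → SlideSeq t K J → SlideSeq (suc t) I J

data Side : Set where
  sX sY : Side

module Construction (I : MCInstance) (lab : Pair (MCInstance.k I) ↔ Fin (MCInstance.k I C 2)) where
  open MCInstance I

  M : ℕ
  M = k C 2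

  label : Fin m → Fin M
  label e = Inverse.to lab ((col (proj₁ (edge e)) , col (proj₂ (edge e))) , edge-col e)

  data V' : Set where
    orig  : Fin n → V'
    edgeV : Fin m → V'
    xv    : Fin M → V'
    yv    : Fin M → V'
    pathV : Side → Fin m → Fin 3 → V'
      -- internal vertices of the path from x_{label e} (sX) or
      -- y_{label e} (sY) to v_e; position 0 next to x/y, 2 next to v_e
    zv    : Fin n → V'

  endV : Side → Fin M → V'
  endV sX b = xv b
  endV sY b = yv b

  data E : V' → V' → Set where
    e-u  : ∀ e → E (orig (proj₁ (edge e))) (edgeV e)
    e-v  : ∀ e → E (orig (proj₂ (edge e))) (edgeV e)
    p-s  : ∀ s e → E (endV s (label e)) (pathV s e 0F)
    p-01 : ∀ s e → E (pathV s e 0F) (pathV s e (sucF 0F))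
    p-12 : ∀ s e → E (pathV s e (sucF 0F)) (pathV s e (sucF (sucF 0F)))
    p-e  : ∀ s e → E (pathV s e (sucF (sucF 0F))) (edgeV e)
    z-v  : ∀ v → E (zv v) (orig v)

  Adj : V' → V' → Set
  Adj x y = E x y ⊎ E y x

  -- U = U₁ ∪ U₂: middle internal vertices of all paths.
  -- S = V ∪ X ∪ U,  T = V ∪ Y ∪ U.
  S : V' → Set
  S (orig _)      = ⊤
  S (edgeV _)     = ⊥
  S (xv _)        = ⊤
  S (yv _)        = ⊥
  S (pathV _ _ p) = p ≡ sucF 0F
  S (zv _)        = ⊥

  T : V' → Set
  T (orig _)      = ⊤
  T (edgeV _)     = ⊥
  T (xv _)        = ⊥
  T (yv _)        = ⊤
  T (pathV _ _ p) = p ≡ sucF 0F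
  T (zv _)        = ⊥

  open TokenSliding Adj public

  ℓ : ℕ
  ℓ = 8 * M + 2 * k

-- Let f choose the clique vertex of each class. First the token on every f i slides to z_{f i}
-- (k slides), so that both endpoints of every clique edge become free. Then, for each label b,
-- the token on x_b reaches y_b in 8 slides through v_e for the clique edge e of label b: on the
-- X-path the middle token steps forward into v_e and the x_b token follows it, and on the
-- Y-path the same walk runs backwards. Finally the k clique tokens slide back, which gives
-- k + 8 (k choose 2) + k = ℓ slides.
module Submission where

open import Defs
open import Data.Empty using (⊥; ⊥-elim)
open import Data.Fin using (Fin; toℕ; fromℕ<) renaming (zero to 0F; suc to sucF)
open import Data.Fin.Properties using (toℕ-injective; toℕ-fromℕ<; toℕ<n)
import Data.Fin.Properties as Fin
open import Data.List using (List; []; _∷_; length; map; allFin)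
open import Data.List.Properties using (length-map; length-tabulate)
open import Data.List.Membership.Propositional using (_∈_; _∉_)
open import Data.List.Membership.Propositional.Properties using (∈-map⁺; ∈-allFin)
open import Data.List.Relation.Unary.All.Properties using (All¬⇒¬Any)
open import Data.List.Relation.Unary.Any using (here; there)
open import Data.List.Relation.Unary.Unique.Propositional using (Unique; []; _∷_)
import Data.List.Relation.Unary.Unique.Propositional.Properties as Unique
open import Data.Nat using (ℕ; zero; suc; _+_; _*_; _≤_; _<_; z≤n; s≤s; s≤s⁻¹)
open import Data.Nat.Combinatorics using (_C_)
open import Data.Nat.Properties
  using (≤-reflexive; <⇒≱; <-irrefl; <⇒≤; ≤∧≢⇒<; m<n⇒m<1+n; n<1+n; m≤n+m; +-comm; <-irrelevant)
open import Data.Nat.Tactic.RingSolver using (solve-∀)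
import Data.Product.Properties as Product
import Data.Product as ×
open import Data.Product using (∃-syntax; _×_; _,_; proj₁; proj₂)
import Data.Sum.Properties as Sum
open import Data.Sum using (_⊎_; inj₁; inj₂; map₁)
open import Data.Unit using (⊤; tt)
open import Function.Bundles using (_↔_; Inverse; mk↣)
open import Relation.Binary.Definitions using (Symmetric; DecidableEquality)
open import Relation.Binary.PropositionalEquality using (_≡_; _≢_; refl; sym; trans; cong; cong₂; subst; module ≡-Reasoning)
open import Relation.Nullary using (¬_; yes; no)
open import Relation.Nullary.Decidable using (via-injection)

module TokenSlidingProperties
  {V : Set} (Adj : V → V → Set)
  (adj-sym : Symmetric Adj) (adj-irrefl : ∀ {x} → ¬ Adj x x) (_≟_ : DecidableEquality V)
  where

  open TokenSliding Adj

  infixl 25 _[_↦_]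

  _[_↦_] : VSet → V → V → VSet
  (A [ u ↦ w ]) x = (A x × x ≢ u) ⊎ x ≡ w

  ≐-refl : ∀ {A} → A ≐ A
  ≐-refl x = (λ a → a) , (λ a → a)

  ≐-sym : ∀ {A B} → A ≐ B → B ≐ A
  ≐-sym eq x = proj₂ (eq x) , proj₁ (eq x)

  ≐-trans : ∀ {A B C} → A ≐ B → B ≐ C → A ≐ C
  ≐-trans p q x = (λ a → proj₁ (q x) (proj₁ (p x) a)) , (λ c → proj₂ (p x) (proj₂ (q x) c))

  [↦]-cong : ∀ {A B u w} → A ≐ B → A [ u ↦ w ] ≐ B [ u ↦ w ]
  [↦]-cong eq x = map₁ (×.map₁ (proj₁ (eq x))) , map₁ (×.map₁ (proj₂ (eq x)))

  ∈-[↦] : ∀ A {u w x} → x ≢ u → A x → (A [ u ↦ w ]) x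
  ∈-[↦] A x≢u a = inj₁ (a , x≢u)

  ∉-[↦] : ∀ A {u w x} → x ≢ w → ¬ A x → ¬ (A [ u ↦ w ]) x
  ∉-[↦] A x≢w ¬a (inj₁ (a , _)) = ¬a a
  ∉-[↦] A x≢w ¬a (inj₂ x≡w) = x≢w x≡w

  new-∈-[↦] : ∀ A {u w x} → ¬ A x → (A [ u ↦ w ]) x → x ≡ w
  new-∈-[↦] A ¬a (inj₁ (a , _)) = ⊥-elim (¬a a)
  new-∈-[↦] A ¬a (inj₂ x≡w) = x≡w

  source-∉-[↦] : ∀ A {u w} → u ≢ w → ¬ (A [ u ↦ w ]) u
  source-∉-[↦] A u≢w (inj₁ (_ , u≢u)) = u≢u refl
  source-∉-[↦] A u≢w (inj₂ u≡w) = u≢w u≡w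

  [↦]-∘ : ∀ {A u w w′} → ¬ A w → A [ u ↦ w ] [ w ↦ w′ ] ≐ A [ u ↦ w′ ]
  [↦]-∘ {A} {u} {w} {w′} ¬Aw x = to , from
    where
    to : (A [ u ↦ w ] [ w ↦ w′ ]) x → (A [ u ↦ w′ ]) x
    to (inj₁ (inj₁ a , _)) = inj₁ a
    to (inj₁ (inj₂ x≡w , x≢w)) = ⊥-elim (x≢w x≡w)
    to (inj₂ x≡w′) = inj₂ x≡w′
    from : (A [ u ↦ w′ ]) x → (A [ u ↦ w ] [ w ↦ w′ ]) x
    from (inj₁ (a , x≢u)) = inj₁ (inj₁ (a , x≢u) , λ { refl → ¬Aw a })
    from (inj₂ x≡w′) = inj₂ x≡w′

  [↦]-swap : ∀ {A u v w} → A u → u ≢ v → w ≢ v → A [ u ↦ w ] [ v ↦ u ] ≐ A [ v ↦ w ]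
  [↦]-swap {A} {u} {v} {w} Au u≢v w≢v x = to , from
    where
    to : (A [ u ↦ w ] [ v ↦ u ]) x → (A [ v ↦ w ]) x
    to (inj₁ (inj₁ (a , _) , x≢v)) = inj₁ (a , x≢v)
    to (inj₁ (inj₂ x≡w , _)) = inj₂ x≡w
    to (inj₂ refl) = inj₁ (Au , u≢v)
    from : (A [ v ↦ w ]) x → (A [ u ↦ w ] [ v ↦ u ]) x
    from (inj₁ (a , x≢v)) with x ≟ u
    ... | yes x≡u = inj₂ x≡u
    ... | no x≢u = inj₁ (inj₁ (a , x≢u) , x≢v)
    from (inj₂ refl) = inj₁ (inj₂ refl , w≢v)

  slide-[↦] : ∀ {A u w} → Independent A → A u → ¬ A w → Adj u w →
              (∀ x → Adj x w → A x → x ≡ u) → Slide A (A [ u ↦ w ])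
  slide-[↦] {A} {u} {w} indA Au ¬Aw u~w w-nbrs =
    u , w , Au , ¬Aw , u~w , (λ x → (λ b → b) , (λ b → b)) , independent
    where
    independent : Independent (A [ u ↦ w ])
    independent x y (inj₁ (Ax , _)) (inj₁ (Ay , _)) x~y = indA x y Ax Ay x~y
    independent x y (inj₁ (Ax , x≢u)) (inj₂ refl) x~w = x≢u (w-nbrs x x~w Ax)
    independent x y (inj₂ refl) (inj₁ (Ay , y≢u)) w~y = y≢u (w-nbrs y (adj-sym w~y) Ay)
    independent x y (inj₂ refl) (inj₂ refl) w~w = adj-irrefl w~w

  slide-independent : ∀ {A B} → Slide A B → Independent B
  slide-independent (_ , _ , _ , _ , _ , _ , indB) = indB

  slide-reverse : ∀ {A B} → Independent A → Slide A B → Slide B A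
  slide-reverse {A} {B} indA (u , w , Au , ¬Aw , u~w , B≡A[u↦w] , indB) =
    w , u , Bw , ¬Bu , adj-sym u~w , (λ x → to x , from x) , indA
    where
    Bw : B w
    Bw = proj₂ (B≡A[u↦w] w) (inj₂ refl)
    ¬Bu : ¬ B u
    ¬Bu Bu with proj₁ (B≡A[u↦w] u) Bu
    ... | inj₁ (_ , u≢u) = u≢u refl
    ... | inj₂ refl = adj-irrefl u~w
    to : ∀ x → A x → (B x × x ≢ w) ⊎ x ≡ u
    to x Ax with x ≟ u
    ... | yes x≡u = inj₂ x≡u
    ... | no x≢u = inj₁ (proj₂ (B≡A[u↦w] x) (inj₁ (Ax , x≢u)) , λ { refl → ¬Aw Ax })
    from : ∀ x → (B x × x ≢ w) ⊎ x ≡ u → A x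
    from x (inj₁ (Bx , x≢w)) with proj₁ (B≡A[u↦w] x) Bx
    ... | inj₁ (Ax , _) = Ax
    ... | inj₂ x≡w = ⊥-elim (x≢w x≡w)
    from x (inj₂ refl) = Au

  slide-respects-≐ : ∀ {A A′ B} → A ≐ A′ → Slide A′ B → Slide A B
  slide-respects-≐ {A} {A′} {B} eq (u , w , A′u , ¬A′w , u~w , B≡A′[u↦w] , indB) =
    u , w , proj₂ (eq u) A′u , (λ Aw → ¬A′w (proj₁ (eq w) Aw)) , u~w ,
    (λ x → (λ Bx → proj₂ ([↦]-cong eq x) (proj₁ (B≡A′[u↦w] x) Bx)) ,
           (λ b → proj₂ (B≡A′[u↦w] x) (proj₁ ([↦]-cong eq x) b))) ,
    indB

  ≐-source : ∀ {t A A′ B} → A ≐ A′ → SlideSeq t A′ B → SlideSeq t A B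
  ≐-source eq (done e) = done (≐-trans eq e)
  ≐-source eq (step s q) = step (slide-respects-≐ eq s) q

  ≐-target : ∀ {t A B B′} → SlideSeq t A B → B ≐ B′ → SlideSeq t A B′
  ≐-target (done e) eq = done (≐-trans e eq)
  ≐-target (step s q) eq = step s (≐-target q eq)

  weaken : ∀ {t t′ A B} → t ≤ t′ → SlideSeq t A B → SlideSeq t′ A B
  weaken t≤t′ (done e) = done e
  weaken (s≤s t≤t′) (step s q) = step s (weaken t≤t′ q)

  infixr 5 _++_

  _++_ : ∀ {a b A K B} → SlideSeq a A K → SlideSeq b K B → SlideSeq (a + b) A B
  _++_ {a} {b} (done e) q = weaken (m≤n+m b a) (≐-source e q)
  step s p ++ q = step s (p ++ q)

  reverse : ∀ {t A B} → Independent A → SlideSeq t A B → SlideSeq t B A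
  reverse indA (done e) = done (≐-sym e)
  reverse {suc t} indA (step s q) =
    weaken (≤-reflexive (+-comm t 1))
      (reverse (slide-independent s) q ++ step (slide-reverse indA s) (done ≐-refl))

  iterate : ∀ {t} (St : ℕ → VSet) (N : ℕ) →
            (∀ c → c < N → SlideSeq t (St c) (St (suc c))) → SlideSeq (N * t) (St 0) (St N)
  iterate St zero steps = done ≐-refl
  iterate {t} St (suc N) steps =
    weaken (≤-reflexive (+-comm (N * t) t))
      (iterate St N (λ c c<N → steps c (m<n⇒m<1+n c<N)) ++ steps N (n<1+n N))

module ConstructionProperties (I : MCInstance) (lab : Pair (MCInstance.k I) ↔ Fin (MCInstance.k I C 2)) where

  open MCInstance I
  open Construction I lab

  E-≢ : ∀ {x y} → E x y → x ≢ y
  E-≢ (e-u _) ()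
  E-≢ (e-v _) ()
  E-≢ (p-s sX _) ()
  E-≢ (p-s sY _) ()
  E-≢ (p-01 _ _) ()
  E-≢ (p-12 _ _) ()
  E-≢ (p-e _ _) ()
  E-≢ (z-v _) ()

  Adj-sym : Symmetric Adj
  Adj-sym (inj₁ xy) = inj₂ xy
  Adj-sym (inj₂ yx) = inj₁ yx

  Adj-irrefl : ∀ {x} → ¬ Adj x x
  Adj-irrefl (inj₁ xx) = E-≢ xx refl
  Adj-irrefl (inj₂ xx) = E-≢ xx refl

  _≟S_ : DecidableEquality Side
  sX ≟S sX = yes refl
  sX ≟S sY = no λ ()
  sY ≟S sX = no λ ()
  sY ≟S sY = yes refl

  Code : Set
  Code = Fin n ⊎ Fin m ⊎ Fin M ⊎ Fin M ⊎ (Side × Fin m × Fin 3) ⊎ Fin n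

  encode : V' → Code
  encode (orig v)      = inj₁ v
  encode (edgeV e)     = inj₂ (inj₁ e)
  encode (xv b)        = inj₂ (inj₂ (inj₁ b))
  encode (yv b)        = inj₂ (inj₂ (inj₂ (inj₁ b)))
  encode (pathV s e p) = inj₂ (inj₂ (inj₂ (inj₂ (inj₁ (s , e , p)))))
  encode (zv v)        = inj₂ (inj₂ (inj₂ (inj₂ (inj₂ v))))

  encode-injective : ∀ {x y} → encode x ≡ encode y → x ≡ y
  encode-injective {orig _}      {orig _}      refl = refl
  encode-injective {edgeV _}     {edgeV _}     refl = refl
  encode-injective {xv _}        {xv _}        refl = refl
  encode-injective {yv _}        {yv _}        refl = refl
  encode-injective {pathV _ _ _} {pathV _ _ _} refl = refl
  encode-injective {zv _}        {zv _}        refl = refl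

  _≟V_ : DecidableEquality V'
  _≟V_ = via-injection (mk↣ encode-injective)
           (Sum.≡-dec Fin._≟_ (Sum.≡-dec Fin._≟_ (Sum.≡-dec Fin._≟_ (Sum.≡-dec Fin._≟_
             (Sum.≡-dec (Product.≡-dec _≟S_ (Product.≡-dec Fin._≟_ Fin._≟_)) Fin._≟_)))))

  open TokenSlidingProperties Adj Adj-sym Adj-irrefl _≟V_ public

  pathPred pathSucc : Side → Fin m → Fin 3 → V'
  pathPred s e 0F               = endV s (label e)
  pathPred s e (sucF 0F)        = pathV s e 0F
  pathPred s e (sucF (sucF 0F)) = pathV s e (sucF 0F)
  pathSucc s e 0F               = pathV s e (sucF 0F)
  pathSucc s e (sucF 0F)        = pathV s e (sucF (sucF 0F))
  pathSucc s e (sucF (sucF 0F)) = edgeV e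

  -- Edges out of x_b and y_b are never inspected, so they are left unconstrained.
  OutNeighbour : V' → V' → Set
  OutNeighbour (orig _)      x = ∃[ e ] x ≡ edgeV e
  OutNeighbour (edgeV _)     x = ⊥
  OutNeighbour (xv _)        x = ⊤
  OutNeighbour (yv _)        x = ⊤
  OutNeighbour (pathV s e p) x = x ≡ pathSucc s e p
  OutNeighbour (zv v)        x = x ≡ orig v

  E⇒OutNeighbour : ∀ {y x} → E y x → OutNeighbour y x
  E⇒OutNeighbour (e-u e)     = e , refl
  E⇒OutNeighbour (e-v e)     = e , refl
  E⇒OutNeighbour (p-s sX _)  = tt
  E⇒OutNeighbour (p-s sY _)  = tt
  E⇒OutNeighbour (p-01 _ _)  = refl
  E⇒OutNeighbour (p-12 _ _)  = refl
  E⇒OutNeighbour (p-e _ _)   = refl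
  E⇒OutNeighbour (z-v _)     = refl

  Adj-orig : ∀ {x v} → Adj x (orig v) → x ≡ zv v ⊎ ∃[ e ] x ≡ edgeV e
  Adj-orig (inj₁ (z-v _)) = inj₁ refl
  Adj-orig (inj₂ orig→x) = inj₂ (E⇒OutNeighbour orig→x)

  Adj-pathV : ∀ {x s e p} → Adj x (pathV s e p) → x ≡ pathPred s e p ⊎ x ≡ pathSucc s e p
  Adj-pathV (inj₁ (p-s _ _))  = inj₁ refl
  Adj-pathV (inj₁ (p-01 _ _)) = inj₁ refl
  Adj-pathV (inj₁ (p-12 _ _)) = inj₁ refl
  Adj-pathV (inj₂ path→x)     = inj₂ (E⇒OutNeighbour path→x)

  Adj-edgeV : ∀ {x e} → Adj x (edgeV e) →
              x ≡ orig (proj₁ (edge e)) ⊎ x ≡ orig (proj₂ (edge e)) ⊎ ∃[ s ] x ≡ pathV s e (sucF (sucF 0F))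
  Adj-edgeV (inj₁ (e-u _))   = inj₁ refl
  Adj-edgeV (inj₁ (e-v _))   = inj₂ (inj₁ refl)
  Adj-edgeV (inj₁ (p-e s _)) = inj₂ (inj₂ (s , refl))
  Adj-edgeV (inj₂ edge→x)    = ⊥-elim (E⇒OutNeighbour edge→x)

  endV-≢-pathV : ∀ s {b s′ e p} → endV s b ≢ pathV s′ e p
  endV-≢-pathV sX ()
  endV-≢-pathV sY ()

  endV-≢-edgeV : ∀ s {b e} → endV s b ≢ edgeV e
  endV-≢-edgeV sX ()
  endV-≢-edgeV sY ()

  move-endV-to-edgeV :
    ∀ s e {A} → Independent A →
    A (endV s (label e)) → A (pathV s e (sucF 0F)) → ¬ A (pathV s e 0F) →
    (∀ s′ → ¬ A (pathV s′ e (sucF (sucF 0F)))) → ¬ A (edgeV e) →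
    ¬ A (orig (proj₁ (edge e))) → ¬ A (orig (proj₂ (edge e))) →
    SlideSeq 4 A (A [ endV s (label e) ↦ edgeV e ])
  move-endV-to-edgeV s e {A} indA Ab Ap₁ ¬Ap₀ ¬Ap₂ ¬Ave ¬Au ¬Av =
    step slide₁ (step slide₂ (step slide₃ (step slide₄ (done arrived))))
    where
    b = endV s (label e)
    p₀ = pathV s e 0F
    p₁ = pathV s e (sucF 0F)
    p₂ = pathV s e (sucF (sucF 0F))
    ve = edgeV e
    A₁ = A [ p₁ ↦ p₂ ]
    A₂ = A₁ [ p₂ ↦ ve ]
    A₃ = A₂ [ b ↦ p₀ ]

    slide₁ : Slide A A₁
    slide₁ = slide-[↦] indA Ap₁ (¬Ap₂ s) (inj₁ (p-12 s e)) nbrs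
      where
      nbrs : ∀ x → Adj x p₂ → A x → x ≡ p₁
      nbrs x x~p₂ Ax with Adj-pathV x~p₂
      ... | inj₁ x≡p₁ = x≡p₁
      ... | inj₂ refl = ⊥-elim (¬Ave Ax)

    slide₂ : Slide A₁ A₂
    slide₂ = slide-[↦] (slide-independent slide₁) (inj₂ refl) (∉-[↦] A (λ ()) ¬Ave) (inj₁ (p-e s e)) nbrs
      where
      nbrs : ∀ x → Adj x ve → A₁ x → x ≡ p₂
      nbrs x x~ve A₁x with Adj-edgeV x~ve
      ... | inj₁ refl = ⊥-elim (∉-[↦] A (λ ()) ¬Au A₁x)
      ... | inj₂ (inj₁ refl) = ⊥-elim (∉-[↦] A (λ ()) ¬Av A₁x)
      ... | inj₂ (inj₂ (s′ , refl)) = new-∈-[↦] A (¬Ap₂ s′) A₁x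

    slide₃ : Slide A₂ A₃
    slide₃ = slide-[↦] (slide-independent slide₂)
               (∈-[↦] A₁ (endV-≢-pathV s) (∈-[↦] A (endV-≢-pathV s) Ab))
               (∉-[↦] A₁ (λ ()) (∉-[↦] A (λ ()) ¬Ap₀)) (inj₁ (p-s s e)) nbrs
      where
      nbrs : ∀ x → Adj x p₀ → A₂ x → x ≡ b
      nbrs x x~p₀ A₂x with Adj-pathV x~p₀
      ... | inj₁ x≡b = x≡b
      ... | inj₂ refl = ⊥-elim (∉-[↦] A₁ (λ ()) (source-∉-[↦] A (λ ())) A₂x)

    slide₄ : Slide A₃ (A₃ [ p₀ ↦ p₁ ])
    slide₄ = slide-[↦] (slide-independent slide₃) (inj₂ refl)
               (∉-[↦] A₂ (λ ()) (∉-[↦] A₁ (λ ()) (source-∉-[↦] A (λ ())))) (inj₁ (p-01 s e)) nbrs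
      where
      nbrs : ∀ x → Adj x p₁ → A₃ x → x ≡ p₀
      nbrs x x~p₁ A₃x with Adj-pathV x~p₁
      ... | inj₁ x≡p₀ = x≡p₀
      ... | inj₂ refl = ⊥-elim (∉-[↦] A₂ (λ ()) (source-∉-[↦] A₁ (λ ())) A₃x)

    arrived : A₃ [ p₀ ↦ p₁ ] ≐ A [ b ↦ ve ]
    arrived =
      ≐-trans ([↦]-∘ (∉-[↦] A₁ (λ ()) (∉-[↦] A (λ ()) ¬Ap₀)))
        (≐-trans ([↦]-cong ([↦]-∘ (¬Ap₂ s)))
          ([↦]-swap Ap₁ (λ p₁≡b → endV-≢-pathV s (sym p₁≡b)) (λ ve≡b → endV-≢-edgeV s (sym ve≡b))))

  -- Tokens of the vertices in parked sit on z_v instead of v, and the tokens of the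
  -- labels b with toℕ b < c have already been moved from x_b to y_b.
  Config : (Fin n → Set) → ℕ → VSet
  Config parked c (orig v)      = ¬ parked v
  Config parked c (edgeV _)     = ⊥
  Config parked c (xv b)        = c ≤ toℕ b
  Config parked c (yv b)        = toℕ b < c
  Config parked c (pathV _ _ p) = p ≡ sucF 0F
  Config parked c (zv v)        = parked v

  Config-independent : ∀ parked c → Independent (Config parked c)
  Config-independent parked c x y Cx Cy (inj₁ x→y) = no-edge x→y Cx Cy
    where
    no-edge : ∀ {x y} → E x y → Config parked c x → Config parked c y → ⊥
    no-edge (e-u _)    _ ()
    no-edge (e-v _)    _ ()
    no-edge (p-s _ _)  _ ()
    no-edge (p-01 _ _) () _
    no-edge (p-12 _ _) _ ()
    no-edge (p-e _ _)  _ ()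
    no-edge (z-v _)    isParked notParked = notParked isParked
  Config-independent parked c x y Cx Cy (inj₂ y→x) = Config-independent parked c y x Cy Cx (inj₁ y→x)

  unpark-head : ∀ {a vs} c → a ∉ vs → Config (_∈ a ∷ vs) c [ zv a ↦ orig a ] ≐ Config (_∈ vs) c
  unpark-head {a} {vs} c a∉vs (orig v) = to , from
    where
    to : (Config (_∈ a ∷ vs) c [ zv a ↦ orig a ]) (orig v) → v ∉ vs
    to (inj₁ (v∉a∷vs , _)) = λ v∈vs → v∉a∷vs (there v∈vs)
    to (inj₂ refl) = a∉vs
    from : v ∉ vs → (Config (_∈ a ∷ vs) c [ zv a ↦ orig a ]) (orig v)
    from v∉vs with v Fin.≟ a
    ... | yes refl = inj₂ refl
    ... | no v≢a = inj₁ ((λ { (here v≡a) → v≢a v≡a ; (there v∈vs) → v∉vs v∈vs }) , λ ())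
  unpark-head {a} {vs} c a∉vs (zv v) = to , from
    where
    to : (Config (_∈ a ∷ vs) c [ zv a ↦ orig a ]) (zv v) → v ∈ vs
    to (inj₁ (here refl , zv≢zv)) = ⊥-elim (zv≢zv refl)
    to (inj₁ (there v∈vs , _)) = v∈vs
    from : v ∈ vs → (Config (_∈ a ∷ vs) c [ zv a ↦ orig a ]) (zv v)
    from v∈vs = inj₁ (there v∈vs , λ { refl → a∉vs v∈vs })
  unpark-head c a∉vs (edgeV _)     = (λ { (inj₁ (() , _)) ; (inj₂ ()) }) , λ ()
  unpark-head c a∉vs (xv _)        = (λ { (inj₁ (Cx , _)) → Cx ; (inj₂ ()) }) , λ Cx → inj₁ (Cx , λ ())
  unpark-head c a∉vs (yv _)        = (λ { (inj₁ (Cx , _)) → Cx ; (inj₂ ()) }) , λ Cx → inj₁ (Cx , λ ())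
  unpark-head c a∉vs (pathV _ _ _) = (λ { (inj₁ (Cx , _)) → Cx ; (inj₂ ()) }) , λ Cx → inj₁ (Cx , λ ())

  unpark : ∀ c vs → Unique vs → SlideSeq (length vs) (Config (_∈ vs) c) (Config (_∈ []) c)
  unpark c [] [] = done ≐-refl
  unpark c (a ∷ vs) (a≢vs ∷ unique) =
    step (slide-[↦] (Config-independent _ c) (here refl) (λ a∉a∷vs → a∉a∷vs (here refl)) (inj₁ (z-v a)) nbrs)
         (≐-source (unpark-head c (All¬⇒¬Any a≢vs)) (unpark c vs unique))
    where
    nbrs : ∀ x → Adj x (orig a) → Config (_∈ a ∷ vs) c x → x ≡ zv a
    nbrs x x~a Cx with Adj-orig x~a
    ... | inj₁ x≡zv = x≡zv
    ... | inj₂ (_ , refl) = ⊥-elim Cx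

  park : ∀ c vs → Unique vs → SlideSeq (length vs) (Config (_∈ []) c) (Config (_∈ vs) c)
  park c vs unique = reverse (Config-independent _ c) (unpark c vs unique)

  transfer-midpoint : ∀ parked {c b} w → toℕ b ≡ c →
                      Config parked c [ xv b ↦ w ] ≐ Config parked (suc c) [ yv b ↦ w ]
  transfer-midpoint parked {c} {b} w b≡c = λ
    { (xv b′)        → map₁ (xv-to b′) , map₁ (xv-from b′)
    ; (yv b′)        → map₁ (yv-to b′) , map₁ (yv-from b′)
    ; (orig _)       → map₁ (retarget λ ()) , map₁ (retarget λ ())
    ; (edgeV _)      → map₁ (retarget λ ()) , map₁ (retarget λ ())
    ; (pathV _ _ _)  → map₁ (retarget λ ()) , map₁ (retarget λ ())
    ; (zv _)         → map₁ (retarget λ ()) , map₁ (retarget λ ())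
    }
    where
    retarget : ∀ {Q : Set} {x y y′ : V'} → x ≢ y′ → Q × x ≢ y → Q × x ≢ y′
    retarget x≢y′ (q , _) = q , x≢y′
    xv-to : ∀ b′ → c ≤ toℕ b′ × xv b′ ≢ xv b → c < toℕ b′ × xv b′ ≢ yv b
    xv-to b′ (c≤b′ , b′≢b) =
      ≤∧≢⇒< c≤b′ (λ c≡b′ → b′≢b (cong xv (toℕ-injective (sym (trans b≡c c≡b′))))) , λ ()
    xv-from : ∀ b′ → c < toℕ b′ × xv b′ ≢ yv b → c ≤ toℕ b′ × xv b′ ≢ xv b
    xv-from b′ (c<b′ , _) = <⇒≤ c<b′ , λ { refl → <-irrefl (sym b≡c) c<b′ }
    yv-to : ∀ b′ → toℕ b′ < c × yv b′ ≢ xv b → toℕ b′ < suc c × yv b′ ≢ yv b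
    yv-to b′ (b′<c , _) = m<n⇒m<1+n b′<c , λ { refl → <-irrefl b≡c b′<c }
    yv-from : ∀ b′ → toℕ b′ < suc c × yv b′ ≢ yv b → toℕ b′ < c × yv b′ ≢ xv b
    yv-from b′ (b′≤c , b′≢b) =
      ≤∧≢⇒< (s≤s⁻¹ b′≤c) (λ b′≡c → b′≢b (cong yv (toℕ-injective (trans b′≡c (sym b≡c))))) , λ ()

  transfer-label : ∀ parked c e → toℕ (label e) ≡ c →
                   parked (proj₁ (edge e)) → parked (proj₂ (edge e)) →
                   SlideSeq 8 (Config parked c) (Config parked (suc c))
  transfer-label parked c e label≡c u-parked v-parked =
    move-endV-to-edgeV sX e (Config-independent parked c) (≤-reflexive (sym label≡c)) refl
      (λ ()) (λ _ ()) (λ ()) (λ ¬u → ¬u u-parked) (λ ¬v → ¬v v-parked)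
    ++ ≐-source (transfer-midpoint parked (edgeV e) label≡c)
         (reverse (Config-independent parked (suc c))
           (move-endV-to-edgeV sY e (Config-independent parked (suc c)) (s≤s (≤-reflexive label≡c)) refl
             (λ ()) (λ _ ()) (λ ()) (λ ¬u → ¬u u-parked) (λ ¬v → ¬v v-parked)))

  Pair-≡ : ∀ {p q : Pair k} → proj₁ p ≡ proj₁ q → p ≡ q
  Pair-≡ {_ , i<j} {_ , i<j′} refl = cong (_ ,_) (<-irrelevant i<j i<j′)

  module Clique (clique-instance : YesInstance I) where

    f : Fin k → Fin n
    f = proj₁ clique-instance

    col-f : ∀ i → col (f i) ≡ i
    col-f = proj₁ (proj₂ clique-instance)

    clique : List (Fin n)
    clique = map f (allFin k)

    clique-unique : Unique clique
    clique-unique = Unique.map⁺ f-injective (Unique.allFin⁺ k)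
      where
      f-injective : ∀ {i j} → f i ≡ f j → i ≡ j
      f-injective {i} {j} fi≡fj = trans (sym (col-f i)) (trans (cong col fi≡fj) (col-f j))

    length-clique : length clique ≡ k
    length-clique = trans (length-map f (allFin k)) (length-tabulate (λ i → i))

    label-has-clique-edge : ∀ b → ∃[ e ] label e ≡ b × proj₁ (edge e) ∈ clique × proj₂ (edge e) ∈ clique
    label-has-clique-edge b =
      e , label≡b , subst (_∈ clique) (sym (cong proj₁ edge≡)) (∈-map⁺ f (∈-allFin i))
                           , subst (_∈ clique) (sym (cong proj₂ edge≡)) (∈-map⁺ f (∈-allFin j))
      where
      i = proj₁ (proj₁ (Inverse.from lab b))
      j = proj₂ (proj₁ (Inverse.from lab b))
      e = proj₁ (proj₂ (proj₂ clique-instance) i j (proj₂ (Inverse.from lab b)))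
      edge≡ : edge e ≡ (f i , f j)
      edge≡ = proj₂ (proj₂ (proj₂ clique-instance) i j (proj₂ (Inverse.from lab b)))
      label≡b : label e ≡ b
      label≡b = begin
        label e                             ≡⟨ cong (Inverse.to lab) (Pair-≡ endpoint-colours) ⟩
        Inverse.to lab (Inverse.from lab b) ≡⟨ Inverse.strictlyInverseˡ lab b ⟩
        b                                   ∎
        where
        open ≡-Reasoning
        endpoint-colours : (col (proj₁ (edge e)) , col (proj₂ (edge e))) ≡ (i , j)
        endpoint-colours =
          trans (cong (λ uv → col (proj₁ uv) , col (proj₂ uv)) edge≡) (cong₂ _,_ (col-f i) (col-f j))

    transfer-all : SlideSeq (M * 8) (Config (_∈ clique) 0) (Config (_∈ clique) M)
    transfer-all = iterate (Config (_∈ clique)) M transfer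
      where
      transfer : ∀ c → c < M → SlideSeq 8 (Config (_∈ clique) c) (Config (_∈ clique) (suc c))
      transfer c c<M with label-has-clique-edge (fromℕ< c<M)
      ... | e , label≡b , u∈clique , v∈clique =
        transfer-label (_∈ clique) c e (trans (cong toℕ label≡b) (toℕ-fromℕ< c<M)) u∈clique v∈clique

  S≐Config : S ≐ Config (_∈ []) 0
  S≐Config (orig _)      = (λ _ ()) , _
  S≐Config (edgeV _)     = (λ ()) , (λ ())
  S≐Config (xv _)        = (λ _ → z≤n) , _
  S≐Config (yv _)        = (λ ()) , (λ ())
  S≐Config (pathV _ _ _) = (λ p≡1 → p≡1) , (λ p≡1 → p≡1)
  S≐Config (zv _)        = (λ ()) , (λ ())

  Config≐T : Config (_∈ []) M ≐ T
  Config≐T (orig _)      = _ , (λ _ ())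
  Config≐T (edgeV _)     = (λ ()) , (λ ())
  Config≐T (xv b)        = (<⇒≱ (toℕ<n b)) , (λ ())
  Config≐T (yv b)        = _ , (λ _ → toℕ<n b)
  Config≐T (pathV _ _ _) = (λ p≡1 → p≡1) , (λ p≡1 → p≡1)
  Config≐T (zv _)        = (λ ()) , (λ ())

ℓ-budget : ∀ k M → k + (M * 8 + k) ≡ 8 * M + 2 * k
ℓ-budget = solve-∀

lemma5p2 : (I : MCInstance)
    → (lab : Pair (MCInstance.k I) ↔ Fin (MCInstance.k I C 2))
    → YesInstance I
    → Construction.SlideSeq I lab (Construction.ℓ I lab) (Construction.S I lab) (Construction.T I lab)
lemma5p2 I lab clique-instance =
  weaken (≤-reflexive (subst (λ L → L + (M * 8 + L) ≡ ℓ) (sym length-clique) (ℓ-budget k M)))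
    (≐-source S≐Config
      (park 0 clique clique-unique ++ transfer-all ++ ≐-target (unpark M clique clique-unique) Config≐T))
  where
  open MCInstance I using (k)
  open Construction I lab using (M; ℓ)
  open ConstructionProperties I lab
  open Clique clique-instance
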